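{- Let $q$ be a prime power, $n=tt'$ with integers $t,t'\ge2$. For any L-$q^t$-partially scattered $q$-polynomial $f(x)=\sum_{i=0}^{n-1}a_ix^{q^i}\in\mathbb{F}_{q^n}[x]$ and any $m\in\mathbb{F}_{q^n}$, the $q$-polynomial $f(x)+mx$ is L-$q^t$-partially scattered.
   Context: A $q$-polynomial $f$ over $\mathbb{F}_{q^n}$ is L-$q^t$-partially scattered if for all $y,z\in\mathbb{F}_{q^n}^*$, $f(y)/y=f(z)/z$ implies $y/z\in\mathbb{F}_{q^t}$. -}

module Defs where

open import Level using (_⊔_)
open import Algebra.Bundles using (CommutativeRing)
open import Data.Nat using (ℕ; zero; suc; _^_; _≤_)
open import Data.Nat.Primality using (Prime)
open import Data.Fin using (Fin) renaming (zero to fzero; suc to fsuc)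
open import Data.Nat.Properties using (_≟_)
open import Data.Product using (Σ; ∃; _×_)
open import Relation.Nullary using (¬_; yes; no)
open import Relation.Binary.PropositionalEquality using (_≡_)

IsPrimePower : ℕ → Set
IsPrimePower q = Σ ℕ λ p → Σ ℕ λ k → Prime p × 1 ≤ k × q ≡ p ^ k

record IsFiniteFieldOfOrder {c ℓ} (R : CommutativeRing c ℓ) (N : ℕ) : Set (c ⊔ ℓ) where
  open CommutativeRing R
  field
    0≉1             : ¬ (0# ≈ 1#)
    _⁻¹             : Carrier → Carrier
    ⁻¹-inverse      : ∀ x → ¬ (x ≈ 0#) → x * (x ⁻¹) ≈ 1#
    enum            : Fin N → Carrier
    enum-injective  : ∀ i j → enum i ≈ enum j → i ≡ j
    enum-surjective : ∀ x → ∃ λ i → enum i ≈ x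

module _ {c ℓ} (R : CommutativeRing c ℓ) where
  open CommutativeRing R

  pow : Carrier → ℕ → Carrier
  pow x zero    = 1#
  pow x (suc m) = x * pow x m

  sumFin : (n : ℕ) → (Fin n → Carrier) → Carrier
  sumFin zero    g = 0#
  sumFin (suc n) g = g fzero + sumFin n (λ i → g (fsuc i))

  qPolyEval : (q n : ℕ) → (Fin n → Carrier) → Carrier → Carrier
  qPolyEval q n a x = sumFin n (λ i → a i * pow x (q ^ Data.Fin.toℕ i))

  -- coefficient vector of f(x) + m x  (add m to the coefficient of x = x^{q^0})
  addLinear : (n : ℕ) → (Fin n → Carrier) → Carrier → Fin n → Carrier
  addLinear n a m i with Data.Fin.toℕ i ≟ 0
  ... | yes _ = a i + m
  ... | no  _ = a i

  InSubfield : (q t : ℕ) → Carrier → Set ℓ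
  InSubfield q t w = pow w (q ^ t) ≈ w

  module _ {N : ℕ} (F : IsFiniteFieldOfOrder R N) where
    open IsFiniteFieldOfOrder F

    LPartiallyScattered : (q t : ℕ) → (Carrier → Carrier) → Set (c ⊔ ℓ)
    LPartiallyScattered q t f =
      ∀ y z → ¬ (y ≈ 0#) → ¬ (z ≈ 0#) →
      f y * (y ⁻¹) ≈ f z * (z ⁻¹) → InSubfield q t (y * (z ⁻¹))

-- Adding m x to f adds the constant m to the quotient f(y)/y, so the relation
-- f(y)/y = f(z)/z is the same for f and for f + m x.
module Submission where

open import Defs
open import Level using (Level)
open import Algebra.Bundles using (CommutativeRing)
open import Data.Nat using (ℕ; _^_; _≤_; suc; s≤s)
open import Data.Fin using (Fin; toℕ) renaming (zero to fzero; suc to fsuc)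
open import Relation.Binary.PropositionalEquality using (_≡_; refl)
open import Relation.Nullary using (¬_)
import Algebra.Properties.Ring as RingProperties
import Relation.Binary.Reasoning.Setoid as SetoidReasoning

module _ {c ℓ : Level} (R : CommutativeRing c ℓ) where
  open CommutativeRing R
  open RingProperties ring using (+-cancelʳ)
  open SetoidReasoning setoid

  qPolyEval-addLinear : ∀ q k (a : Fin (suc k) → Carrier) m y →
    qPolyEval R q (suc k) (addLinear R (suc k) a m) y ≈ qPolyEval R q (suc k) a y + m * y
  qPolyEval-addLinear q k a m y = begin
    (a fzero + m) * x + S     ≈⟨ +-congʳ (distribʳ x (a fzero) m) ⟩
    (a fzero * x + m * x) + S ≈⟨ +-assoc _ _ _ ⟩
    a fzero * x + (m * x + S) ≈⟨ +-congˡ (+-comm _ _) ⟩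
    a fzero * x + (S + m * x) ≈⟨ +-assoc _ _ _ ⟨
    (a fzero * x + S) + m * x ≈⟨ +-congˡ (*-congˡ (*-identityʳ y)) ⟩
    (a fzero * x + S) + m * y ∎
    where
      x = pow R y 1
      S = sumFin R k (λ i → a (fsuc i) * pow R y (q ^ toℕ (fsuc i)))

  [x+m*y]*y′≈x*y′+m : ∀ x m y y′ → y * y′ ≈ 1# → (x + m * y) * y′ ≈ x * y′ + m
  [x+m*y]*y′≈x*y′+m x m y y′ yy′≈1 = begin
    (x + m * y) * y′       ≈⟨ distribʳ _ _ _ ⟩
    x * y′ + (m * y) * y′  ≈⟨ +-congˡ (*-assoc _ _ _) ⟩
    x * y′ + m * (y * y′)  ≈⟨ +-congˡ (*-congˡ yy′≈1) ⟩
    x * y′ + m * 1#        ≈⟨ +-congˡ (*-identityʳ m) ⟩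
    x * y′ + m             ∎

  module _ {N : ℕ} (F : IsFiniteFieldOfOrder R N) where
    open IsFiniteFieldOfOrder F

    LPartiallyScattered-+linear : ∀ q t (f g : Carrier → Carrier) m →
      (∀ x → g x ≈ f x + m * x) →
      LPartiallyScattered R F q t f → LPartiallyScattered R F q t g
    LPartiallyScattered-+linear q t f g m g≈f+mx f-scattered y z y≉0 z≉0 eq =
      f-scattered y z y≉0 z≉0 (+-cancelʳ m _ _ (begin
        f y * y ⁻¹ + m          ≈⟨ quotient y y≉0 ⟨
        g y * y ⁻¹              ≈⟨ eq ⟩
        g z * z ⁻¹              ≈⟨ quotient z z≉0 ⟩
        f z * z ⁻¹ + m          ∎))
      where
        quotient : ∀ x → ¬ (x ≈ 0#) → g x * x ⁻¹ ≈ f x * x ⁻¹ + m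
        quotient x x≉0 = trans (*-congʳ (g≈f+mx x))
                               ([x+m*y]*y′≈x*y′+m (f x) m x (x ⁻¹) (⁻¹-inverse x x≉0))

open import Data.Nat using (_*_)

proposition2p8 : ∀ {c ℓ : Level} (q t t′ n : ℕ) → IsPrimePower q → 2 ≤ t → 2 ≤ t′ → n ≡ t * t′ →
    (R : CommutativeRing c ℓ) (F : IsFiniteFieldOfOrder R (q ^ n)) →
    (a : Fin n → CommutativeRing.Carrier R) →
    LPartiallyScattered R F q t (qPolyEval R q n a) →
    (m : CommutativeRing.Carrier R) →
    LPartiallyScattered R F q t (qPolyEval R q n (addLinear R n a m))
proposition2p8 q t@(suc _) (suc _) _ _ (s≤s _) (s≤s _) refl R F a f-scattered m =
  LPartiallyScattered-+linear R F q t _ _ m (qPolyEval-addLinear R q _ a m) f-scattered
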